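{- Let $P$ be a closed and guarded sequential ITMPC process term (containing no parallel composition operator). Then $P\xrightarrow{a,\lambda}P'$ if and only if $\Gamma_{\mathrm l}[\![P]\!]\xrightarrow{\lambda}_{\mathrm M}Q$ for an OTMPC term $Q$ whose only transition is $Q\xrightarrow{a}\Gamma_{\mathrm l}[\![P']\!]$.
   Context: Let $\mathit{Name}=\mathit{Name}_{\mathrm v}\cup\{\tau\}$ ($\tau$ internal, $\mathit{Name}_{\mathrm v}$ visible names); relabelings $\varphi:\mathit{Name}\to\mathit{Name}$ satisfy $\varphi^{ -1}(\tau)=\{\tau\}$; $\mathit{Var}$ is a set of process variables. ITMPC terms: $P ::= \underline{0} \mid \langle a,\lambda\rangle . P \mid P+P \mid P \parallel_S P \mid P/H \mid P[\varphi] \mid X \mid \mathrm{rec}\,X:P$ ($a\in\mathit{Name}$, $\lambda>0$, $S,H\subseteq\mathit{Name}_{\mathrm v}$). Transitions $P\xrightarrow{a,\lambda}P'$ form a multiset (multiplicity = number of derivations) generated by: $\langle a,\lambda\rangle.P\xrightarrow{a,\lambda}P$; either summand of $+$ may move; interleaving of $\parallel_S$ operands for $a\notin S$ and synchronization for $a\in S$ with rate $\lambda_1\otimes\lambda_2$ ($\otimes$ a fixed associative commutative operation on $\mathbb{R}_{>0}$); $P/H$ turns names in $H$ into $\tau$ (keeping the rate); $P[\varphi]$ relabels $a$ to $\varphi(a)$; $\mathrm{rec}\,X:P$ moves as its unfolding $P\{\mathrm{rec}\,X:P\hookrightarrow X\}$. OTMPC terms: $Q ::= \underline{0} \mid a.Q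 \mid (\lambda).Q \mid Q+Q \mid Q\parallel_S Q \mid Q/H \mid Q[\varphi] \mid X \mid \mathrm{rec}\,X:Q$. Action transitions $Q\xrightarrow{a}Q'$ (a set) arise from $a.Q\xrightarrow{a}Q$, with the standard rules for $+$ (either summand), $\parallel_S$ (interleaving for $a\notin S$, synchronization for $a\in S$), hiding ($a\in H$ becomes $\tau$), relabeling, recursion unfolding; $(\lambda).Q$ has no action transitions. Time transitions $Q\xrightarrow{\lambda}_{\mathrm M}Q'$ (a multiset with derivation multiplicities) arise from $(\lambda).Q\xrightarrow{\lambda}_{\mathrm M}Q$ and are propagated by $+$ (either summand), $\parallel_S$ (either operand independently), hiding, relabeling and recursion unfolding. "Transition" refers to both kinds. $\Gamma_{\mathrm l}$: $\Gamma_{\mathrm l}[\![\underline 0]\!]=\underline 0$; $\Gamma_{\mathrm l}[\![\langle a,\lambda\rangle.P]\!]=(\lambda).a.\Gamma_{\mathrm l}[\![P]\!]$; $\Gamma_{\mathrm l}[\![P_1+P_2]\!]=\Gamma_{\mathrm l}[\![P_1]\!]+\Gamma_{\mathrm l}[\![P_2]\!]$; $\Gamma_{\mathrm l}[\![P/H]\!]=\Gamma_{\mathrm l}[\![P]\!]/H$; $\Gamma_{\mathrm l}[\![P[\varphi]]\!]=\Gamma_{\mathrm l}[\![P]\!][\varphi]$; $\Gamma_{\mathrm l}[\![X]\!]=X$; $\Gamma_{\mathrm l}[\![\mathrm{rec}\,X:P]\!]=\mathrm{rec}\,X:\Gamma_{\mathrm l}[\![P]\!]$. -}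

module Defs where

open import Data.Nat using (ℕ)
open import Data.Nat.Properties using (_≟_)
open import Data.Empty using (⊥)
open import Data.Unit using (⊤)
open import Level using (Lift)
open import Data.Product using (_×_)
open import Relation.Nullary using (¬_; yes; no)
open import Relation.Binary.PropositionalEquality using (_≡_; _≢_)

-- V    : the set Name_v of visible names
-- Rate : the carrier of the rates (positive reals in the paper, kept abstract)
-- _⊗_  : the fixed operation used to combine rates in synchronisations
module Setup (V : Set) (Rate : Set) (_⊗_ : Rate → Rate → Rate) where

  data Name : Set where
    τ   : Name
    vis : V → Name

  Var : Set
  Var = ℕ

  NSet : Set₁
  NSet = V → Set

  _∈N_ : Name → NSet → Set
  τ     ∈N S = ⊥
  vis v ∈N S = S v

  -- a relabeling φ : Name → Name with φ⁻¹(τ) = {τ} is exactly a map V → V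
  -- on visible names, extended by τ ↦ τ
  Relab : Set
  Relab = V → V

  ren : Relab → Name → Name
  ren φ τ       = τ
  ren φ (vis v) = vis (φ v)

  data ITerm : Set₁ where
    𝟘      : ITerm
    ⟨_,_⟩·_ : Name → Rate → ITerm → ITerm
    _⊕_    : ITerm → ITerm → ITerm
    _∥[_]_ : ITerm → NSet → ITerm → ITerm
    _/_    : ITerm → NSet → ITerm
    _[_]   : ITerm → Relab → ITerm
    var    : Var → ITerm
    rec    : Var → ITerm → ITerm

  -- P {Q ↪ X}: replace free occurrences of X in P by Q
  -- (only ever used with Q closed, so no capture can occur)
  sub : ITerm → Var → ITerm → ITerm
  sub 𝟘 X Q = 𝟘
  sub (⟨ a , r ⟩· P) X Q = ⟨ a , r ⟩· sub P X Q
  sub (P₁ ⊕ P₂) X Q = sub P₁ X Q ⊕ sub P₂ X Q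
  sub (P₁ ∥[ S ] P₂) X Q = sub P₁ X Q ∥[ S ] sub P₂ X Q
  sub (P / H) X Q = sub P X Q / H
  sub (P [ φ ]) X Q = sub P X Q [ φ ]
  sub (var Y) X Q with Y ≟ X
  ... | yes _ = Q
  ... | no  _ = var Y
  sub (rec Y P) X Q with Y ≟ X
  ... | yes _ = rec Y P
  ... | no  _ = rec Y (sub P X Q)

  data FreeIn (X : Var) : ITerm → Set₁ where
    pre  : ∀ {a r P} → FreeIn X P → FreeIn X (⟨ a , r ⟩· P)
    sumL : ∀ {P Q} → FreeIn X P → FreeIn X (P ⊕ Q)
    sumR : ∀ {P Q} → FreeIn X Q → FreeIn X (P ⊕ Q)
    parL : ∀ {P S Q} → FreeIn X P → FreeIn X (P ∥[ S ] Q)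
    parR : ∀ {P S Q} → FreeIn X Q → FreeIn X (P ∥[ S ] Q)
    hid  : ∀ {P H} → FreeIn X P → FreeIn X (P / H)
    rel  : ∀ {P φ} → FreeIn X P → FreeIn X (P [ φ ])
    here : FreeIn X (var X)
    recF : ∀ {Y P} → Y ≢ X → FreeIn X P → FreeIn X (rec Y P)

  Closed : ITerm → Set₁
  Closed P = ∀ X → ¬ FreeIn X P

  GuardedIn : Var → ITerm → Set₁
  GuardedIn X 𝟘 = Lift _ ⊤
  GuardedIn X (⟨ a , r ⟩· P) = Lift _ ⊤
  GuardedIn X (P ⊕ Q) = GuardedIn X P × GuardedIn X Q
  GuardedIn X (P ∥[ S ] Q) = GuardedIn X P × GuardedIn X Q
  GuardedIn X (P / H) = GuardedIn X P
  GuardedIn X (P [ φ ]) = GuardedIn X P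
  GuardedIn X (var Y) = Lift _ (Y ≢ X)
  GuardedIn X (rec Y P) with Y ≟ X
  ... | yes _ = Lift _ ⊤
  ... | no  _ = GuardedIn X P

  data Guarded : ITerm → Set₁ where
    nil  : Guarded 𝟘
    pre  : ∀ {a r P} → Guarded P → Guarded (⟨ a , r ⟩· P)
    sum  : ∀ {P Q} → Guarded P → Guarded Q → Guarded (P ⊕ Q)
    par  : ∀ {P S Q} → Guarded P → Guarded Q → Guarded (P ∥[ S ] Q)
    hid  : ∀ {P H} → Guarded P → Guarded (P / H)
    rel  : ∀ {P φ} → Guarded P → Guarded (P [ φ ])
    var  : ∀ {X} → Guarded (var X)
    recG : ∀ {X P} → GuardedIn X P → Guarded P → Guarded (rec X P)

  data Seq : ITerm → Set₁ where
    nil : Seq 𝟘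
    pre : ∀ {a r P} → Seq P → Seq (⟨ a , r ⟩· P)
    sum : ∀ {P Q} → Seq P → Seq Q → Seq (P ⊕ Q)
    hid : ∀ {P H} → Seq P → Seq (P / H)
    rel : ∀ {P φ} → Seq P → Seq (P [ φ ])
    var : ∀ {X} → Seq (var X)
    rc  : ∀ {X P} → Seq P → Seq (rec X P)

  -- ITMPC transitions P ─[ a , λ ]→ P'; each inhabitant is a derivation,
  -- so the multiplicity is the number of inhabitants
  infix 4 _─[_,_]→_
  data _─[_,_]→_ : ITerm → Name → Rate → ITerm → Set₁ where
    pre   : ∀ {a r P} → ⟨ a , r ⟩· P ─[ a , r ]→ P
    sumL  : ∀ {P Q a r P'} → P ─[ a , r ]→ P' → P ⊕ Q ─[ a , r ]→ P'
    sumR  : ∀ {P Q a r Q'} → Q ─[ a , r ]→ Q' → P ⊕ Q ─[ a , r ]→ Q'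
    parL  : ∀ {P S Q a r P'} → P ─[ a , r ]→ P' → ¬ (a ∈N S) →
            P ∥[ S ] Q ─[ a , r ]→ P' ∥[ S ] Q
    parR  : ∀ {P S Q a r Q'} → Q ─[ a , r ]→ Q' → ¬ (a ∈N S) →
            P ∥[ S ] Q ─[ a , r ]→ P ∥[ S ] Q'
    sync  : ∀ {P S Q a r₁ r₂ P' Q'} → P ─[ a , r₁ ]→ P' → Q ─[ a , r₂ ]→ Q' →
            a ∈N S → P ∥[ S ] Q ─[ a , r₁ ⊗ r₂ ]→ P' ∥[ S ] Q'
    hidIn : ∀ {P H v r P'} → P ─[ vis v , r ]→ P' → H v → P / H ─[ τ , r ]→ P' / H
    hidOut : ∀ {P H a r P'} → P ─[ a , r ]→ P' → ¬ (a ∈N H) → P / H ─[ a , r ]→ P' / H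
    rel   : ∀ {P φ a r P'} → P ─[ a , r ]→ P' → P [ φ ] ─[ ren φ a , r ]→ P' [ φ ]
    unf   : ∀ {X P a r P'} → sub P X (rec X P) ─[ a , r ]→ P' → rec X P ─[ a , r ]→ P'

  data OTerm : Set₁ where
    𝟘      : OTerm
    _·_    : Name → OTerm → OTerm
    ⦅_⦆·_  : Rate → OTerm → OTerm
    _⊕_    : OTerm → OTerm → OTerm
    _∥[_]_ : OTerm → NSet → OTerm → OTerm
    _/_    : OTerm → NSet → OTerm
    _[_]   : OTerm → Relab → OTerm
    var    : Var → OTerm
    rec    : Var → OTerm → OTerm

  osub : OTerm → Var → OTerm → OTerm
  osub 𝟘 X Q = 𝟘
  osub (a · P) X Q = a · osub P X Q
  osub (⦅ r ⦆· P) X Q = ⦅ r ⦆· osub P X Q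
  osub (P₁ ⊕ P₂) X Q = osub P₁ X Q ⊕ osub P₂ X Q
  osub (P₁ ∥[ S ] P₂) X Q = osub P₁ X Q ∥[ S ] osub P₂ X Q
  osub (P / H) X Q = osub P X Q / H
  osub (P [ φ ]) X Q = osub P X Q [ φ ]
  osub (var Y) X Q with Y ≟ X
  ... | yes _ = Q
  ... | no  _ = var Y
  osub (rec Y P) X Q with Y ≟ X
  ... | yes _ = rec Y P
  ... | no  _ = rec Y (osub P X Q)

  infix 4 _─[_]→_
  data _─[_]→_ : OTerm → Name → OTerm → Set₁ where
    act   : ∀ {a P} → a · P ─[ a ]→ P
    sumL  : ∀ {P Q a P'} → P ─[ a ]→ P' → P ⊕ Q ─[ a ]→ P'
    sumR  : ∀ {P Q a Q'} → Q ─[ a ]→ Q' → P ⊕ Q ─[ a ]→ Q'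
    parL  : ∀ {P S Q a P'} → P ─[ a ]→ P' → ¬ (a ∈N S) →
            P ∥[ S ] Q ─[ a ]→ P' ∥[ S ] Q
    parR  : ∀ {P S Q a Q'} → Q ─[ a ]→ Q' → ¬ (a ∈N S) →
            P ∥[ S ] Q ─[ a ]→ P ∥[ S ] Q'
    sync  : ∀ {P S Q a P' Q'} → P ─[ a ]→ P' → Q ─[ a ]→ Q' →
            a ∈N S → P ∥[ S ] Q ─[ a ]→ P' ∥[ S ] Q'
    hidIn : ∀ {P H v P'} → P ─[ vis v ]→ P' → H v → P / H ─[ τ ]→ P' / H
    hidOut : ∀ {P H a P'} → P ─[ a ]→ P' → ¬ (a ∈N H) → P / H ─[ a ]→ P' / H
    rel   : ∀ {P φ a P'} → P ─[ a ]→ P' → P [ φ ] ─[ ren φ a ]→ P' [ φ ]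
    unf   : ∀ {X P a P'} → osub P X (rec X P) ─[ a ]→ P' → rec X P ─[ a ]→ P'

  -- time transitions Q ─⟪ λ ⟫→M Q' (multiplicity = number of derivations)
  infix 4 _─⟪_⟫→M_
  data _─⟪_⟫→M_ : OTerm → Rate → OTerm → Set₁ where
    del   : ∀ {r P} → ⦅ r ⦆· P ─⟪ r ⟫→M P
    sumL  : ∀ {P Q r P'} → P ─⟪ r ⟫→M P' → P ⊕ Q ─⟪ r ⟫→M P'
    sumR  : ∀ {P Q r Q'} → Q ─⟪ r ⟫→M Q' → P ⊕ Q ─⟪ r ⟫→M Q'
    parL  : ∀ {P S Q r P'} → P ─⟪ r ⟫→M P' → P ∥[ S ] Q ─⟪ r ⟫→M P' ∥[ S ] Q
    parR  : ∀ {P S Q r Q'} → Q ─⟪ r ⟫→M Q' → P ∥[ S ] Q ─⟪ r ⟫→M P ∥[ S ] Q'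
    hid   : ∀ {P H r P'} → P ─⟪ r ⟫→M P' → P / H ─⟪ r ⟫→M P' / H
    rel   : ∀ {P φ r P'} → P ─⟪ r ⟫→M P' → P [ φ ] ─⟪ r ⟫→M P' [ φ ]
    unf   : ∀ {X P r P'} → osub P X (rec X P) ─⟪ r ⟫→M P' → rec X P ─⟪ r ⟫→M P'

  OnlyTransition : OTerm → Name → OTerm → Set₁
  OnlyTransition Q a Q' =
    (Q ─[ a ]→ Q')
    × (∀ b R → Q ─[ b ]→ R → (b ≡ a) × (R ≡ Q'))
    × (∀ r R → ¬ (Q ─⟪ r ⟫→M R))

  Γl : (P : ITerm) → Seq P → OTerm
  Γl 𝟘 nil = 𝟘
  Γl (⟨ a , r ⟩· P) (pre s) = ⦅ r ⦆· (a · Γl P s)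
  Γl (P ⊕ Q) (sum s t) = Γl P s ⊕ Γl Q t
  Γl (P / H) (hid s) = Γl P s / H
  Γl (P [ φ ]) (rel s) = Γl P s [ φ ]
  Γl (var X) var = var X
  Γl (rec X P) (rc s) = rec X (Γl P s)

-- In a sequential term, an ITMPC move P ─[a,λ]→ P' is fired
-- by one prefix ⟨a,λ⟩.P' reached through choices, unfoldings, hidings and
-- relabelings.  The image Γl P has a delay (λ) at that very place, and
-- after the delay it is left with a.Γl P' wrapped only in the hidings and
-- relabelings that were passed.  Such a wrapped action prefix (the notion
-- `ActionPrefixed` below) has exactly one transition, the action itself.
-- Conversely, a delay of Γl P followed by an action retraces an ITMPC move
-- of P whose target translates to the action's target.
module Submission where

open import Defs
-- the pair constructor is renamed: `_,_` would clash with `P ─[ a , r ]→ P'`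
open import Data.Product using (Σ; _×_) renaming (_,_ to _&_)
open import Function.Bundles using (_⇔_; mk⇔)
open import Data.Nat.Properties using (_≟_)
open import Relation.Nullary using (¬_; yes; no)
open import Relation.Binary.PropositionalEquality
  using (_≡_; refl; sym; trans; cong; cong₂; subst)
open import Data.Empty using (⊥-elim)

module Translation (V Rate : Set) (_⊗_ : Rate → Rate → Rate) where
  open Setup V Rate _⊗_

  Γl-irrelevant : ∀ {P} (s t : Seq P) → Γl P s ≡ Γl P t
  Γl-irrelevant nil       nil       = refl
  Γl-irrelevant (pre s)   (pre t)   = cong (λ Q → ⦅ _ ⦆· (_ · Q)) (Γl-irrelevant s t)
  Γl-irrelevant (sum s u) (sum t w) = cong₂ _⊕_ (Γl-irrelevant s t) (Γl-irrelevant u w)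
  Γl-irrelevant (hid s)   (hid t)   = cong (_/ _) (Γl-irrelevant s t)
  Γl-irrelevant (rel s)   (rel t)   = cong (_[ _ ]) (Γl-irrelevant s t)
  Γl-irrelevant var       var       = refl
  Γl-irrelevant (rc s)    (rc t)    = cong (rec _) (Γl-irrelevant s t)

  sub-Seq : ∀ {P R} X → Seq P → Seq R → Seq (sub P X R)
  sub-Seq X nil       t = nil
  sub-Seq X (pre s)   t = pre (sub-Seq X s t)
  sub-Seq X (sum s u) t = sum (sub-Seq X s t) (sub-Seq X u t)
  sub-Seq X (hid s)   t = hid (sub-Seq X s t)
  sub-Seq X (rel s)   t = rel (sub-Seq X s t)
  sub-Seq X (var {Y}) t with Y ≟ X
  ... | yes _ = t
  ... | no  _ = var
  sub-Seq X (rc {Y} s) t with Y ≟ X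
  ... | yes _ = rc s
  ... | no  _ = rc (sub-Seq X s t)

  Γl-sub : ∀ {P R} X (s : Seq P) (t : Seq R) →
           Γl (sub P X R) (sub-Seq X s t) ≡ osub (Γl P s) X (Γl R t)
  Γl-sub X nil       t = refl
  Γl-sub X (pre s)   t = cong (λ Q → ⦅ _ ⦆· (_ · Q)) (Γl-sub X s t)
  Γl-sub X (sum s u) t = cong₂ _⊕_ (Γl-sub X s t) (Γl-sub X u t)
  Γl-sub X (hid s)   t = cong (_/ _) (Γl-sub X s t)
  Γl-sub X (rel s)   t = cong (_[ _ ]) (Γl-sub X s t)
  Γl-sub X (var {Y}) t with Y ≟ X
  ... | yes _ = refl
  ... | no  _ = refl
  Γl-sub X (rc {Y} s) t with Y ≟ X
  ... | yes _ = refl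
  ... | no  _ = cong (rec Y) (Γl-sub X s t)

  Γl⁻¹ : OTerm → ITerm
  Γl⁻¹ 𝟘               = 𝟘
  Γl⁻¹ (a · Q)         = 𝟘
  Γl⁻¹ (⦅ r ⦆· (a · Q)) = ⟨ a , r ⟩· Γl⁻¹ Q
  Γl⁻¹ (⦅ r ⦆· Q)       = 𝟘
  Γl⁻¹ (Q₁ ⊕ Q₂)       = Γl⁻¹ Q₁ ⊕ Γl⁻¹ Q₂
  Γl⁻¹ (Q₁ ∥[ S ] Q₂)  = 𝟘
  Γl⁻¹ (Q / H)         = Γl⁻¹ Q / H
  Γl⁻¹ (Q [ φ ])       = Γl⁻¹ Q [ φ ]
  Γl⁻¹ (var X)         = var X
  Γl⁻¹ (rec X Q)       = rec X (Γl⁻¹ Q)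

  Γl⁻¹-Γl : ∀ {P} (s : Seq P) → Γl⁻¹ (Γl P s) ≡ P
  Γl⁻¹-Γl nil       = refl
  Γl⁻¹-Γl (pre s)   = cong (⟨ _ , _ ⟩·_) (Γl⁻¹-Γl s)
  Γl⁻¹-Γl (sum s u) = cong₂ _⊕_ (Γl⁻¹-Γl s) (Γl⁻¹-Γl u)
  Γl⁻¹-Γl (hid s)   = cong (_/ _) (Γl⁻¹-Γl s)
  Γl⁻¹-Γl (rel s)   = cong (_[ _ ]) (Γl⁻¹-Γl s)
  Γl⁻¹-Γl var       = refl
  Γl⁻¹-Γl (rc s)    = cong (rec _) (Γl⁻¹-Γl s)

  Γl-injective : ∀ {P P'} (s : Seq P) (s' : Seq P') → Γl P s ≡ Γl P' s' → P ≡ P'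
  Γl-injective s s' e = trans (sym (Γl⁻¹-Γl s)) (trans (cong Γl⁻¹ e) (Γl⁻¹-Γl s'))

  -- These are the terms reached by the delay that Γl puts before an action.
  data ActionPrefixed : OTerm → Name → OTerm → Set₁ where
    act    : ∀ {a R} → ActionPrefixed (a · R) a R
    hidIn  : ∀ {Q v R H} → ActionPrefixed Q (vis v) R → H v →
             ActionPrefixed (Q / H) τ (R / H)
    hidOut : ∀ {Q a R H} → ActionPrefixed Q a R → ¬ (a ∈N H) →
             ActionPrefixed (Q / H) a (R / H)
    rel    : ∀ {Q a R φ} → ActionPrefixed Q a R →
             ActionPrefixed (Q [ φ ]) (ren φ a) (R [ φ ])

  ActionPrefixed⇒OnlyTransition : ∀ {Q a R} → ActionPrefixed Q a R → OnlyTransition Q a R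
  ActionPrefixed⇒OnlyTransition p = step p & unique p & (λ r R' → no-delay p)
    where
    step : ∀ {Q a R} → ActionPrefixed Q a R → Q ─[ a ]→ R
    step act          = act
    step (hidIn p h)  = hidIn (step p) h
    step (hidOut p h) = hidOut (step p) h
    step (rel p)      = rel (step p)

    -- a hidden action cannot also leave the hiding visibly, and vice versa
    unique : ∀ {Q a R} → ActionPrefixed Q a R →
             ∀ b R' → Q ─[ b ]→ R' → (b ≡ a) × (R' ≡ R)
    unique act _ _ act = refl & refl
    unique (hidIn p h) _ _ (hidIn t _) with unique p _ _ t
    ... | refl & refl = refl & refl
    unique (hidIn p h) _ _ (hidOut t h∉) with unique p _ _ t
    ... | refl & refl = ⊥-elim (h∉ h)
    unique (hidOut p h∉) _ _ (hidIn t h) with unique p _ _ t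
    ... | refl & refl = ⊥-elim (h∉ h)
    unique (hidOut p _) _ _ (hidOut t _) with unique p _ _ t
    ... | refl & refl = refl & refl
    unique (rel p) _ _ (rel t) with unique p _ _ t
    ... | refl & refl = refl & refl

    no-delay : ∀ {Q a R r R'} → ActionPrefixed Q a R → ¬ (Q ─⟪ r ⟫→M R')
    no-delay act          ()
    no-delay (hidIn p _)  (hid d) = no-delay p d
    no-delay (hidOut p _) (hid d) = no-delay p d
    no-delay (rel p)      (rel d) = no-delay p d

  delay-of-move : ∀ {P a r P'} → P ─[ a , r ]→ P' → (s : Seq P) (s' : Seq P') →
                  Σ OTerm (λ Q → (Γl P s ─⟪ r ⟫→M Q) × ActionPrefixed Q a (Γl P' s'))
  delay-of-move pre (pre s) s' rewrite Γl-irrelevant s s' = _ & del & act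
  delay-of-move (sumL m) (sum s _) s' with delay-of-move m s s'
  ... | Q & d & p = Q & sumL d & p
  delay-of-move (sumR m) (sum _ u) s' with delay-of-move m u s'
  ... | Q & d & p = Q & sumR d & p
  delay-of-move (hidIn m h) (hid s) (hid s') with delay-of-move m s s'
  ... | Q & d & p = Q / _ & hid d & hidIn p h
  delay-of-move (hidOut m h) (hid s) (hid s') with delay-of-move m s s'
  ... | Q & d & p = Q / _ & hid d & hidOut p h
  delay-of-move (rel m) (rel s) (rel s') with delay-of-move m s s'
  ... | Q & d & p = Q [ _ ] & rel d & rel p
  delay-of-move (unf {X} m) (rc s) s' with delay-of-move m (sub-Seq X s (rc s)) s'
  ... | Q & d & p = Q & unf (subst (_─⟪ _ ⟫→M Q) (Γl-sub X s (rc s)) d) & p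

  -- The source is
  -- given as any G equal to Γl P so that the unfolding case can recurse on
  -- the delay derivation itself (transporting it would break termination).
  move-of-delay : ∀ {a r R G Q} (P : ITerm) (s : Seq P) → Γl P s ≡ G →
                  G ─⟪ r ⟫→M Q → Q ─[ a ]→ R →
                  Σ ITerm (λ P₀ → Σ (Seq P₀) (λ s₀ → (P ─[ a , r ]→ P₀) × (Γl P₀ s₀ ≡ R)))
  move-of-delay _ nil     refl () _
  move-of-delay _ var     refl () _
  move-of-delay _ (pre s) refl del act = _ & s & pre & refl
  move-of-delay _ (sum s _) refl (sumL d) t with move-of-delay _ s refl d t
  ... | P₀ & s₀ & m & e = P₀ & s₀ & sumL m & e
  move-of-delay _ (sum _ u) refl (sumR d) t with move-of-delay _ u refl d t
  ... | P₀ & s₀ & m & e = P₀ & s₀ & sumR m & e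
  move-of-delay _ (hid s) refl (hid d) (hidIn t h) with move-of-delay _ s refl d t
  ... | P₀ & s₀ & m & e = P₀ / _ & hid s₀ & hidIn m h & cong (_/ _) e
  move-of-delay _ (hid s) refl (hid d) (hidOut t h) with move-of-delay _ s refl d t
  ... | P₀ & s₀ & m & e = P₀ / _ & hid s₀ & hidOut m h & cong (_/ _) e
  move-of-delay _ (rel s) refl (rel d) (rel t) with move-of-delay _ s refl d t
  ... | P₀ & s₀ & m & e = P₀ [ _ ] & rel s₀ & rel m & cong (_[ _ ]) e
  move-of-delay _ (rc {X} s) refl (unf d) t
    with move-of-delay _ (sub-Seq X s (rc s)) (Γl-sub X s (rc s)) d t
  ... | P₀ & s₀ & m & e = P₀ & s₀ & unf m & e

lemma3 : (V Rate : Set) (_⊗_ : Rate → Rate → Rate) →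
    let open Setup V Rate _⊗_ in
    (P P' : ITerm) (sP : Seq P) (sP' : Seq P') →
    Closed P → Guarded P →
    (a : Name) (r : Rate) →
    (P ─[ a , r ]→ P') ⇔ Σ OTerm (λ Q → (Γl P sP ─⟪ r ⟫→M Q) × OnlyTransition Q a (Γl P' sP'))
lemma3 V Rate _⊗_ P P' sP sP' _ _ a r = mk⇔ forward backward
  where
  open Setup V Rate _⊗_
  open Translation V Rate _⊗_

  Image : Set₁
  Image = Σ OTerm (λ Q → (Γl P sP ─⟪ r ⟫→M Q) × OnlyTransition Q a (Γl P' sP'))

  forward : P ─[ a , r ]→ P' → Image
  forward m with delay-of-move m sP sP'
  ... | Q & d & p = Q & d & ActionPrefixed⇒OnlyTransition p

  -- only the existence of the action is needed; injectivity of Γl then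
  -- identifies the recovered target with P'
  backward : Image → P ─[ a , r ]→ P'
  backward (Q & d & t & _) with move-of-delay P sP refl d t
  ... | P₀ & s₀ & m & e = subst (P ─[ a , r ]→_) (Γl-injective s₀ sP' e) m
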